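{- In Maharaja Nim, every row $\{(x,y): x\in\mathbb{N}_0\}$ (for fixed $y\in\mathbb{N}_0$) and every column $\{(x,y): y\in\mathbb{N}_0\}$ (for fixed $x\in\mathbb{N}_0$) of $\mathbb{N}_0\times\mathbb{N}_0$ contains precisely one P-position.
   Context: Maharaja Nim is the two-player impartial game played on positions $(x,y)\in\mathbb{N}_0\times\mathbb{N}_0$ ($\mathbb{N}_0$ the non-negative integers). From $(x,y)$ a move goes to any of: $(x-k,y)$, $(x,y-k)$, $(x-k,y-k)$ for an integer $k\ge1$, or $(x-1,y-2)$, $(x-2,y-1)$, provided the resulting coordinates are non-negative. Players alternate; the player who moves to $(0,0)$ wins (equivalently, a player with no move loses). A position is a P-position if the second player (the player not about to move) has a winning strategy, and an N-position otherwise. -}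

module Defs where

open import Data.Nat using (ℕ; suc; _+_; _≤_)
open import Data.Product using (_×_; _,_; Σ; ∃)

Pos : Set
Pos = ℕ × ℕ

-- Each target is written as a position whose coordinates are the
-- original ones minus a positive amount, which encodes non-negativity.
data Move : Pos → Pos → Set where
  left  : ∀ a k y → Move (a + suc k , y) (a , y)
  down  : ∀ x b k → Move (x , b + suc k) (x , b)
  diag  : ∀ a b k → Move (a + suc k , b + suc k) (a , b)
  knight₁ : ∀ a b → Move (a + 1 , b + 2) (a , b)
  knight₂ : ∀ a b → Move (a + 2 , b + 1) (a , b)

-- Since every move strictly decreases x + y the game is finite, so this
-- inductive characterisation is exactly "second player wins" / "first
-- player wins".
mutual
  data IsP (p : Pos) : Set where
    allToN : (∀ q → Move p q → IsN q) → IsP p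

  data IsN (p : Pos) : Set where
    someToP : ∀ q → Move p q → IsP q → IsN p

-- The game is finite, so every position is either P or N, and no move
-- joins two P-positions; hence a row contains at most one P-position.
-- For existence, induct on the row: if the P-positions of the rows
-- below y all lie in columns ≤ M, then row y has a P-position in a
-- column ≤ M + y + 3, since at X = M + y + 3 every move leaving row y
-- lands in a column > M.  Columns follow by the symmetry (x , y) ↦ (y , x)
-- of the rules.
module Submission where

open import Defs
open import Data.Nat
open import Data.Nat.Properties
open import Data.Nat.Induction using (<-wellFounded)
open import Induction.WellFounded using (Acc; acc)
open import Data.Product using (_×_; _,_; ∃; ∃₂; proj₁; proj₂; swap)
open import Data.Sum using (_⊎_; inj₁; inj₂; [_,_])
open import Data.Empty using (⊥-elim)
open import Function using (_∘_; id)
open import Relation.Nullary using (¬_; Dec; yes; no)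
open import Relation.Nullary.Decidable using (map′)
open import Relation.Binary.PropositionalEquality using (_≡_; _≢_; refl; sym; trans; cong₂; subst; subst₂)
open import Relation.Binary.Definitions using (tri<; tri≈; tri>)

size : Pos → ℕ
size (x , y) = x + y

Move⇒size< : ∀ {p q} → Move p q → size q < size p
Move⇒size< (left a k y)  = +-monoˡ-< y (m<m+n a z<s)
Move⇒size< (down x b k)  = +-monoʳ-< x (m<m+n b z<s)
Move⇒size< (diag a b k)  = +-mono-< (m<m+n a z<s) (m<m+n b z<s)
Move⇒size< (knight₁ a b) = +-mono-< (m<m+n a z<s) (m<m+n b z<s)
Move⇒size< (knight₂ a b) = +-mono-< (m<m+n a z<s) (m<m+n b z<s)

IsP⇒¬IsN : ∀ {p} → IsP p → ¬ IsN p
IsP⇒¬IsN (allToN toN) (someToP q m isP) = IsP⇒¬IsN isP (toN q m)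

IsP-independent : ∀ {p q} → IsP p → IsP q → ¬ Move p q
IsP-independent (allToN toN) isP m = IsP⇒¬IsN isP (toN _ m)

data Step : ℕ → ℕ → Set where
  horizontal : ∀ k → Step (suc k) 0
  vertical   : ∀ k → Step 0 (suc k)
  diagonal   : ∀ k → Step (suc k) (suc k)
  knight₁    : Step 1 2
  knight₂    : Step 2 1

step? : ∀ dx dy → Dec (Step dx dy)
step? zero    zero    = no λ ()
step? (suc k) zero    = yes (horizontal k)
step? zero    (suc k) = yes (vertical k)
step? (suc i) (suc j) with i ≟ j
... | yes refl = yes (diagonal i)
... | no i≢j   = knight? i j i≢j
  where
  knight? : ∀ i j → i ≢ j → Dec (Step (suc i) (suc j))
  knight? zero          zero          i≢j = no λ _ → i≢j refl
  knight? zero          (suc zero)    _   = yes knight₁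
  knight? zero          (suc (suc j)) _   = no λ ()
  knight? (suc zero)    zero          _   = yes knight₂
  knight? (suc (suc i)) zero          _   = no λ ()
  knight? (suc i)       (suc j)       i≢j = no λ { (diagonal _) → i≢j refl }

Step⇒Move : ∀ {dx dy} → Step dx dy → ∀ a b → Move (a + dx , b + dy) (a , b)
Step⇒Move (horizontal k) a b = subst (λ b′ → Move (a + suc k , b′) (a , b)) (sym (+-identityʳ b)) (left a k b)
Step⇒Move (vertical k)   a b = subst (λ a′ → Move (a′ , b + suc k) (a , b)) (sym (+-identityʳ a)) (down a b k)
Step⇒Move (diagonal k)   a b = diag a b k
Step⇒Move knight₁        a b = knight₁ a b
Step⇒Move knight₂        a b = knight₂ a b

Move⇒Step : ∀ {x y a b} → Move (x , y) (a , b) → ∃₂ λ dx dy → Step dx dy × a + dx ≡ x × b + dy ≡ y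
Move⇒Step (left a k y)  = suc k , 0 , horizontal k , refl , +-identityʳ y
Move⇒Step (down x b k)  = 0 , suc k , vertical k , +-identityʳ x , refl
Move⇒Step (diag a b k)  = suc k , suc k , diagonal k , refl , refl
Move⇒Step (knight₁ a b) = 1 , 2 , knight₁ , refl , refl
Move⇒Step (knight₂ a b) = 2 , 1 , knight₂ , refl , refl

Move-from-Step : ∀ {x y a b} → a ≤ x → b ≤ y → Step (x ∸ a) (y ∸ b) → Move (x , y) (a , b)
Move-from-Step {a = a} {b} a≤x b≤y step =
  subst (λ p → Move p (a , b)) (cong₂ _,_ (m+[n∸m]≡n a≤x) (m+[n∸m]≡n b≤y)) (Step⇒Move step a b)

anyBelow? : ∀ {P : ℕ → Set} n → (∀ {i} → i < n → Dec (P i)) → Dec (∃ λ i → i < n × P i)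
anyBelow? {P} n P? = map′ (λ (i , _ , i<n , Pi) → i , i<n , Pi) (λ (i , i<n , Pi) → i , i<n , i<n , Pi)
                          (anyUpTo? below? n)
  where
  below? : ∀ i → Dec (i < n × P i)
  below? i with i <? n
  ... | yes i<n = map′ (i<n ,_) proj₂ (P? i<n)
  ... | no  i≮n = no (i≮n ∘ proj₁)

HasMoveToP : Pos → Set
HasMoveToP p = ∃ λ q → Move p q × IsP q

-- A move from (x , y) is a target (a , b) in the box a ≤ x, b ≤ y whose
-- displacement is a legal step, so the search is finite.
hasMoveToP? : ∀ {x y} → (∀ {q} → Move (x , y) q → Dec (IsP q)) → Dec (HasMoveToP (x , y))
hasMoveToP? {x} {y} isP? =
  map′ toMove fromMove (anyBelow? (suc x) λ a<1+x → anyBelow? (suc y) λ b<1+y → target? a<1+x b<1+y)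
  where
  Target : ℕ → ℕ → Set
  Target a b = Step (x ∸ a) (y ∸ b) × IsP (a , b)

  target? : ∀ {a b} → a < suc x → b < suc y → Dec (Target a b)
  target? {a} {b} a<1+x b<1+y with step? (x ∸ a) (y ∸ b)
  ... | yes step = map′ (step ,_) proj₂ (isP? (Move-from-Step (s≤s⁻¹ a<1+x) (s≤s⁻¹ b<1+y) step))
  ... | no ¬step = no (¬step ∘ proj₁)

  toMove : (∃ λ a → a < suc x × ∃ λ b → b < suc y × Target a b) → HasMoveToP (x , y)
  toMove (a , a<1+x , b , b<1+y , step , isP) =
    (a , b) , Move-from-Step (s≤s⁻¹ a<1+x) (s≤s⁻¹ b<1+y) step , isP

  fromMove : HasMoveToP (x , y) → ∃ λ a → a < suc x × ∃ λ b → b < suc y × Target a b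
  fromMove ((a , b) , m , isP) with Move⇒Step m
  ... | dx , dy , step , refl , refl =
    a , s≤s (m≤m+n a dx) , b , s≤s (m≤m+n b dy) ,
    subst₂ Step (sym (m+n∸m≡n a dx)) (sym (m+n∸m≡n b dy)) step , isP

IsP⊎IsN⇒Dec : ∀ {p} → IsP p ⊎ IsN p → Dec (IsP p)
IsP⊎IsN⇒Dec (inj₁ isP) = yes isP
IsP⊎IsN⇒Dec (inj₂ isN) = no λ isP → IsP⇒¬IsN isP isN

determined-step : ∀ {x y} → (∀ {q} → Move (x , y) q → IsP q ⊎ IsN q) → IsP (x , y) ⊎ IsN (x , y)
determined-step below with hasMoveToP? (IsP⊎IsN⇒Dec ∘ below)
... | yes (q , m , isP) = inj₂ (someToP q m isP)
... | no ¬toP = inj₁ (allToN λ q m → [ (λ isP → ⊥-elim (¬toP (q , m , isP))) , id ] (below m))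

determined : ∀ p → IsP p ⊎ IsN p
determined p = go p (<-wellFounded (size p))
  where
  go : ∀ p → Acc _<_ (size p) → IsP p ⊎ IsN p
  go (x , y) (acc rec) = determined-step λ {q} m → go q (rec (Move⇒size< m))

isP? : ∀ p → Dec (IsP p)
isP? = IsP⊎IsN⇒Dec ∘ determined

leftMove : ∀ {i x} y → i < x → Move (x , y) (i , y)
leftMove {i} {x} y i<x =
  subst (λ x′ → Move (x′ , y) (i , y)) (trans (+-suc i _) (m+[n∸m]≡n i<x)) (left i (x ∸ suc i) y)

row-unique : ∀ {x x′ y} → IsP (x , y) → IsP (x′ , y) → x′ ≡ x
row-unique {x} {x′} {y} isP isP′ with <-cmp x′ x
... | tri< x′<x _ _ = ⊥-elim (IsP-independent isP isP′ (leftMove y x′<x))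
... | tri≈ _ x′≡x _ = x′≡x
... | tri> _ _ x<x′ = ⊥-elim (IsP-independent isP′ isP (leftMove y x<x′))

Move-leftward⊎downward : ∀ {x y a b} → Move (x , y) (a , b) → (b ≡ y × a < x) ⊎ (b < y × x ≤ a + (y + 2))
Move-leftward⊎downward (left a k y)  = inj₁ (refl , m<m+n a z<s)
Move-leftward⊎downward (down x b k)  = inj₂ (m<m+n b z<s , m≤m+n x _)
Move-leftward⊎downward (diag a b k)  =
  inj₂ (m<m+n b z<s , +-monoʳ-≤ a (≤-trans (m≤n+m (suc k) b) (m≤m+n _ 2)))
Move-leftward⊎downward (knight₁ a b) = inj₂ (m<m+n b z<s , +-monoʳ-≤ a (≤-trans (s≤s z≤n) (m≤n+m 2 (b + 2))))
Move-leftward⊎downward (knight₂ a b) = inj₂ (m<m+n b z<s , +-monoʳ-≤ a (m≤n+m 2 (b + 1)))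

LowerRowsBounded : ℕ → ℕ → Set
LowerRowsBounded M y = ∀ {a b} → b < y → IsP (a , b) → a ≤ M

rowBound : ℕ → ℕ → ℕ
rowBound M y = suc (M + (y + 2))

row-has-P : ∀ {M y} → LowerRowsBounded M y → ∃ λ x → x ≤ rowBound M y × IsP (x , y)
row-has-P {M} {y} bounded with anyUpTo? (λ i → isP? (i , y)) (suc (rowBound M y))
... | yes (x , x<1+X , isP) = x , s≤s⁻¹ x<1+X , isP
... | no none with determined (rowBound M y , y)
...   | inj₁ isP = ⊥-elim (none (_ , ≤-refl , isP))
...   | inj₂ (someToP (a , b) m isP) with Move-leftward⊎downward m
...     | inj₁ (refl , a<X) = ⊥-elim (none (a , m<n⇒m<1+n a<X , isP))
...     | inj₂ (b<y , X≤a+y+2) = ⊥-elim (1+n≰n (≤-trans X≤a+y+2 (+-monoˡ-≤ (y + 2) (bounded b<y isP))))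

lowerRowsBounded : ∀ y → ∃ λ M → LowerRowsBounded M y
lowerRowsBounded zero    = 0 , λ ()
lowerRowsBounded (suc y) with lowerRowsBounded y
... | M , bounded with row-has-P bounded
...   | _ , x≤X , isP = rowBound M y , bounded′
  where
  bounded′ : LowerRowsBounded (rowBound M y) (suc y)
  bounded′ {a} b<1+y isPa with m<1+n⇒m<n∨m≡n b<1+y
  ... | inj₁ b<y  = ≤-trans (bounded b<y isPa) (m≤n⇒m≤1+n (m≤m+n M _))
  ... | inj₂ refl = subst (_≤ rowBound M y) (sym (row-unique isP isPa)) x≤X

row-unique-P : ∀ y → ∃ λ x → IsP (x , y) × (∀ x′ → IsP (x′ , y) → x′ ≡ x)
row-unique-P y with row-has-P (proj₂ (lowerRowsBounded y))
... | x , _ , isP = x , isP , λ _ → row-unique isP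

Move-swap : ∀ {p q} → Move p q → Move (swap p) (swap q)
Move-swap (left a k y)  = down y a k
Move-swap (down x b k)  = left b k x
Move-swap (diag a b k)  = diag b a k
Move-swap (knight₁ a b) = knight₂ b a
Move-swap (knight₂ a b) = knight₁ b a

mutual
  IsP-swap : ∀ {p} → IsP p → IsP (swap p)
  IsP-swap (allToN toN) = allToN λ q m → IsN-swap (toN (swap q) (Move-swap m))

  IsN-swap : ∀ {p} → IsN p → IsN (swap p)
  IsN-swap (someToP q m isP) = someToP (swap q) (Move-swap m) (IsP-swap isP)

proposition1 : ((y : ℕ) → ∃ λ x → IsP (x , y) × ((x′ : ℕ) → IsP (x′ , y) → x′ ≡ x))
    × ((x : ℕ) → ∃ λ y → IsP (x , y) × ((y′ : ℕ) → IsP (x , y′) → y′ ≡ y))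
proposition1 = row-unique-P , column-unique-P
  where
  column-unique-P : ∀ x → ∃ λ y → IsP (x , y) × (∀ y′ → IsP (x , y′) → y′ ≡ y)
  column-unique-P x with row-unique-P x
  ... | y , isP , unique = y , IsP-swap isP , λ y′ → unique y′ ∘ IsP-swap
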